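{- Let $a,b$ be real numbers and define the generalized Pell numbers by $P^{a,b}_{0}=b-2a$, $P^{a,b}_{1}=a$, $P^{a,b}_{n+2}=2P^{a,b}_{n+1}+P^{a,b}_{n}$ for $n\ge0$, and $P^{a,b}_{ -1}=P^{a,b}_{1}-2P^{a,b}_{0}=5a-2b$. Then for every nonnegative integer $m$ and every real $c\neq0$, \[ c^{m+1}P^{a,b}_{m+1}=b-2a+\sum_{i=0}^{m}c^{i}\left\{P^{a,b}_{i}+(c-1)P^{a,b}_{i+1}+P^{a,b}_{i-1}\right\}. \]
   Context: The term $P^{a,b}_{ -1}$ appearing for $i=0$ is defined by running the recurrence backward at index $0$. -}

module Defs where

open import Level using (Level)
open import Data.Nat using (ℕ; zero; suc)
open import Algebra.Bundles using (CommutativeRing)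

module PellDefs {c ℓ : Level} (R : CommutativeRing c ℓ) where
  open CommutativeRing R hiding (zero)

  two : Carrier
  two = 1# + 1#

  pow : Carrier → ℕ → Carrier
  pow x zero    = 1#
  pow x (suc n) = x * pow x n

  P : Carrier → Carrier → ℕ → Carrier
  P a b zero          = b - two * a
  P a b (suc zero)    = a
  P a b (suc (suc n)) = two * P a b (suc n) + P a b n

  -- Pprev a b i = P^{a,b}_{i-1}, where P^{a,b}_{-1} = P_1 - 2 P_0
  -- (the recurrence run backward at index 0).
  Pprev : Carrier → Carrier → ℕ → Carrier
  Pprev a b zero    = P a b 1 - two * P a b 0
  Pprev a b (suc i) = P a b i

  sumTo : ℕ → (ℕ → Carrier) → Carrier
  sumTo zero    f = f zero
  sumTo (suc m) f = sumTo m f + f (suc m)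

{-# OPTIONS --safe #-}
module Submission where

-- The recurrence P_{i+1} = 2 P_i + P_{i-1} holds for every i ≥ 0, at i = 0 by the
-- choice of P_{-1}.  Hence the i-th summand plus c^i P_i is c^{i+1} P_{i+1}, and the
-- sum telescopes from c^0 P_0 = b - 2a to c^{m+1} P_{m+1}.  No inverse of c is needed.

open import Defs
open import Level using (Level)
open import Data.Nat using (ℕ; suc; zero)
open import Relation.Nullary using (¬_)
open import Algebra.Bundles using (CommutativeRing)
import Algebra.Properties.Group as GroupProperties
import Algebra.Solver.Ring.NaturalCoefficients.Default as SemiringSolver

module Telescoping {ℓc ℓ : Level} (R : CommutativeRing ℓc ℓ) where
  open CommutativeRing R hiding (zero)
  open PellDefs R
  open import Relation.Binary.Reasoning.Setoid setoid
  open SemiringSolver commutativeSemiring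

  sumTo-telescope : (f g : ℕ → Carrier) → (∀ i → f i + g i ≈ g (suc i)) →
                    ∀ m → sumTo m f + g 0 ≈ g (suc m)
  sumTo-telescope f g step zero    = step zero
  sumTo-telescope f g step (suc m) = begin
    sumTo m f + f (suc m) + g 0   ≈⟨ solve 3 (λ s x y → s :+ x :+ y := x :+ (s :+ y)) refl _ _ _ ⟩
    f (suc m) + (sumTo m f + g 0) ≈⟨ +-congˡ (sumTo-telescope f g step m) ⟩
    f (suc m) + g (suc m)         ≈⟨ step (suc m) ⟩
    g (suc (suc m))               ∎

module PellSum {ℓc ℓ : Level} (R : CommutativeRing ℓc ℓ) (a b : CommutativeRing.Carrier R) where
  open CommutativeRing R hiding (zero)
  open PellDefs R
  open import Relation.Binary.Reasoning.Setoid setoid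
  open SemiringSolver commutativeSemiring
  open GroupProperties +-group using (//-rightDividesˡ)

  P-suc≈two*P+Pprev : ∀ i → P a b (suc i) ≈ two * P a b i + Pprev a b i
  P-suc≈two*P+Pprev zero    = sym (trans (+-comm _ _) (//-rightDividesˡ (two * P a b 0) a))
  P-suc≈two*P+Pprev (suc i) = refl

  summand+pow*P≈pow*P-suc : ∀ c i →
    pow c i * (P a b i + (c - 1#) * P a b (suc i) + Pprev a b i) + pow c i * P a b i
      ≈ pow c (suc i) * P a b (suc i)
  summand+pow*P≈pow*P-suc c i = begin
    x * (p + d * p′ + q) + x * p ≈⟨ regroup d x p p′ q ⟩
    x * ((two * p + q) + d * p′) ≈⟨ *-congˡ (+-congʳ (sym (P-suc≈two*P+Pprev i))) ⟩
    x * (p′ + d * p′)            ≈⟨ collect d x p′ ⟩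
    (d + 1#) * x * p′            ≈⟨ *-congʳ (*-congʳ (//-rightDividesˡ 1# c)) ⟩
    c * x * p′                   ∎
    where
    d = c - 1#
    x = pow c i
    p = P a b i
    p′ = P a b (suc i)
    q = Pprev a b i
    regroup : ∀ d x p p′ q → x * (p + d * p′ + q) + x * p ≈ x * ((two * p + q) + d * p′)
    regroup = solve 5 (λ d x p p′ q → x :* (p :+ d :* p′ :+ q) :+ x :* p
                                   := x :* (((con 1 :+ con 1) :* p :+ q) :+ d :* p′)) refl
    collect : ∀ d x p′ → x * (p′ + d * p′) ≈ (d + 1#) * x * p′
    collect = solve 3 (λ d x p′ → x :* (p′ :+ d :* p′) := (d :+ con 1) :* x :* p′) refl

theorem3 : {ℓc ℓ : Level} (R : CommutativeRing ℓc ℓ) →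
    let open CommutativeRing R
        open PellDefs R
    in (a b : Carrier) (m : ℕ) (c : Carrier) → ¬ (c ≈ 0#) →
       pow c (suc m) * P a b (suc m)
         ≈ (b - two * a) + sumTo m (λ i → pow c i * (P a b i + (c - 1#) * P a b (suc i) + Pprev a b i))
theorem3 R a b m c _ = begin
  pow c (suc m) * P a b (suc m) ≈⟨ sumTo-telescope _ (λ i → pow c i * P a b i) (summand+pow*P≈pow*P-suc c) m ⟨
  sumTo m _ + 1# * P a b 0      ≈⟨ +-congˡ (*-identityˡ _) ⟩
  sumTo m _ + P a b 0           ≈⟨ +-comm _ _ ⟩
  P a b 0 + sumTo m _           ∎
  where open CommutativeRing R
        open PellDefs R
        open Telescoping R
        open PellSum R a b
        open import Relation.Binary.Reasoning.Setoid setoid
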